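{- Let $G$ be a non-diregular $k$-geodetic digraph that is out-regular of degree $d$ and has order $M(d,k)+\epsilon$. Then every vertex $v'$ with $d^-(v')>d$ satisfies $d+1\leq d^-(v')\leq d+\epsilon$.
   Context: $M(d,k)=1+d+\dots+d^k$. A digraph is $k$-geodetic if for any two vertices $u,v$ there is at most one directed walk from $u$ to $v$ of length at most $k$. -}

module Defs where

open import Data.Nat using (ℕ; zero; suc; _+_; _^_; _≤_)
open import Data.Fin using (Fin)
open import Data.Bool using (Bool; T)
open import Data.List using (List; length; filterᵇ; allFin)
open import Data.Product using (_×_)
open import Relation.Binary.PropositionalEquality using (_≡_)

M : ℕ → ℕ → ℕ
M d zero    = 1
M d (suc k) = M d k + d ^ suc k

-- A digraph on the vertex set Fin n, given by its adjacency relation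
-- (no multiple arcs; loops are not excluded a priori).
record Digraph (n : ℕ) : Set where
  field
    arc : Fin n → Fin n → Bool

module _ {n : ℕ} (G : Digraph n) where
  open Digraph G

  outdeg : Fin n → ℕ
  outdeg u = length (filterᵇ (λ w → arc u w) (allFin n))

  indeg : Fin n → ℕ
  indeg v = length (filterᵇ (λ w → arc w v) (allFin n))

  data Walk : Fin n → Fin n → Set where
    []  : ∀ {u} → Walk u u
    _∷_ : ∀ {u w v} → T (arc u w) → Walk w v → Walk u v

  walkLength : ∀ {u v} → Walk u v → ℕ
  walkLength []      = 0
  walkLength (_ ∷ p) = suc (walkLength p)

  Geodetic : ℕ → Set
  Geodetic k = ∀ {u v} (p q : Walk u v) →
    walkLength p ≤ k → walkLength q ≤ k → p ≡ q

  OutRegular : ℕ → Set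
  OutRegular d = ∀ v → outdeg v ≡ d

  Diregular : ℕ → Set
  Diregular d = ∀ v → outdeg v ≡ d × indeg v ≡ d

-- Fix an in-neighbour u of v′. In a k-geodetic digraph the walks of length at most k from u
-- end in pairwise distinct vertices, so they reach a set E of exactly M(d,k) vertices, and at
-- most ε in-neighbours of v′ lie outside E. An in-neighbour x ∈ E is reached by a unique short
-- walk u ⇝ x; extending it by the arc x → v′ and reading off its first arc u → w gives an
-- out-neighbour w of u. Two such x with the same w yield two walks w ⇝ v′ of length at most k,
-- which coincide, so x is determined by w and at most d in-neighbours of v′ lie in E.
module Submission where

open import Defs
open import Data.Nat using (ℕ; zero; suc; _+_; _*_; _^_; _≤_; _<_; z≤n; s≤s; z<s)
open import Data.Nat.Properties
open import Data.Fin using (Fin; zero; suc) renaming (_≟_ to _≟ᶠ_)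
open import Data.Fin.Properties using (injective⇒≤)
open import Data.Bool using (T)
open import Data.Bool.Properties using (T?)
open import Data.List using (List; []; _∷_; [_]; length; filter; filterᵇ; allFin; map; _++_; lookup)
open import Data.List.Properties using (length-++; length-map; length-tabulate)
open import Data.List.Relation.Unary.All as All using (All; []; _∷_)
import Data.List.Relation.Unary.All.Properties as All
open import Data.List.Relation.Unary.Any using (here; there; index)
open import Data.List.Relation.Unary.Any.Properties using (lookup-index)
open import Data.List.Relation.Unary.AllPairs using ([]; _∷_)
open import Data.List.Relation.Unary.Unique.Propositional using (Unique)
import Data.List.Relation.Unary.Unique.Propositional.Properties as Unique
open import Data.List.Relation.Binary.Subset.Propositional using (_⊆_)
open import Data.List.Membership.Propositional using (_∈_)
open import Data.List.Membership.Propositional.Properties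
  using (∈-lookup; ∈-map⁺; ∈-map⁻; ∈-filter⁺; ∈-filter⁻; ∈-++⁺ˡ; ∈-++⁺ʳ; ∈-allFin)
open import Data.Product using (Σ; ∃; _,_; proj₁; proj₂; _×_)
open import Relation.Nullary using (¬_; yes; no; ¬?; contradiction)
open import Relation.Binary.PropositionalEquality
  using (_≡_; refl; sym; trans; cong; cong₂; module ≡-Reasoning)
open import Function using (_∘_)

module _ {A : Set} where

  lookup-injective : ∀ {xs : List A} → Unique xs → ∀ i j → lookup xs i ≡ lookup xs j → i ≡ j
  lookup-injective (_  ∷ _)  zero    zero    _  = refl
  lookup-injective (x∉ ∷ _)  zero    (suc j) eq = contradiction eq (All.lookup x∉ (∈-lookup j))
  lookup-injective (x∉ ∷ _)  (suc i) zero    eq = contradiction (sym eq) (All.lookup x∉ (∈-lookup i))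
  lookup-injective (_  ∷ xs) (suc i) (suc j) eq = cong suc (lookup-injective xs i j eq)

  nonempty⇒∈ : ∀ {xs : List A} → 0 < length xs → ∃ (_∈ xs)
  nonempty⇒∈ {x ∷ _} _ = x , here refl

  ⊆⇒length-≤ : ∀ {xs ys : List A} → Unique xs → xs ⊆ ys → length xs ≤ length ys
  ⊆⇒length-≤ {xs} {ys} xs! xs⊆ys = injective⇒≤ position-injective
    where
    position : Fin (length xs) → Fin (length ys)
    position i = index (xs⊆ys (∈-lookup i))

    position-injective : ∀ {i j} → position i ≡ position j → i ≡ j
    position-injective {i} {j} eq = lookup-injective xs! i j (begin
      lookup xs i            ≡⟨ lookup-index (xs⊆ys (∈-lookup i)) ⟩
      lookup ys (position i) ≡⟨ cong (lookup ys) eq ⟩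
      lookup ys (position j) ≡⟨ lookup-index (xs⊆ys (∈-lookup j)) ⟨
      lookup xs j            ∎)
      where open ≡-Reasoning

module _ {A B : Set} {f : A → B} where

  map⁺-injectiveOn : ∀ {xs} → (∀ {x y} → x ∈ xs → y ∈ xs → f x ≡ f y → x ≡ y) →
                     Unique xs → Unique (map f xs)
  map⁺-injectiveOn inj []         = []
  map⁺-injectiveOn inj (x∉ ∷ xs!) =
    All.map⁺ (All.tabulate λ y∈ fx≡fy → All.lookup x∉ y∈ (inj (here refl) (there y∈) fx≡fy))
    ∷ map⁺-injectiveOn (λ x∈ y∈ → inj (there x∈) (there y∈)) xs!

M-suc : ∀ d j → suc (d * M d j) ≡ M d (suc j)
M-suc d zero    = refl
M-suc d (suc j) = begin
  suc (d * (M d j + d ^ suc j))   ≡⟨ cong suc (*-distribˡ-+ d (M d j) (d ^ suc j)) ⟩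
  suc (d * M d j) + d * d ^ suc j ≡⟨ cong (_+ d * d ^ suc j) (M-suc d j) ⟩
  M d (suc j) + d ^ suc (suc j)   ∎
  where open ≡-Reasoning

module _ {n : ℕ} (G : Digraph n) where
  open Digraph G
  open import Data.List.Membership.DecPropositional (_≟ᶠ_ {n}) using (_∈?_)

  outNbrs inNbrs : Fin n → List (Fin n)
  outNbrs u = filterᵇ (arc u) (allFin n)
  inNbrs  v = filterᵇ (λ w → arc w v) (allFin n)

  outArcs : ∀ u → All (T ∘ arc u) (outNbrs u)
  outArcs u = All.all-filter (T? ∘ arc u) (allFin n)

  ∈-outNbrs⁺ : ∀ {u w} → T (arc u w) → w ∈ outNbrs u
  ∈-outNbrs⁺ {w = w} = ∈-filter⁺ (T? ∘ _) (∈-allFin w)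

  outNbrs-unique : ∀ u → Unique (outNbrs u)
  outNbrs-unique u = Unique.filter⁺ (T? ∘ arc u) (Unique.allFin⁺ n)

  inNbrs-unique : ∀ v → Unique (inNbrs v)
  inNbrs-unique v = Unique.filter⁺ (T? ∘ λ w → arc w v) (Unique.allFin⁺ n)

  ∈-inNbrs⁻ : ∀ {v w} → w ∈ inNbrs v → T (arc w v)
  ∈-inNbrs⁻ {v} w∈ = proj₂ (∈-filter⁻ (T? ∘ λ w → arc w v) {xs = allFin n} w∈)

  in-neighbour : ∀ {v} → 0 < indeg G v → ∃ λ u → T (arc u v)
  in-neighbour 0<indeg with u , u∈ ← nonempty⇒∈ 0<indeg =
    u , ∈-inNbrs⁻ u∈

  WalkFrom : Fin n → Set
  WalkFrom u = Σ (Fin n) (Walk G u)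

  ∣_∣ : ∀ {u} → WalkFrom u → ℕ
  ∣ s ∣ = walkLength G (proj₂ s)

  _◃_ : ∀ {u w} → T (arc u w) → WalkFrom w → WalkFrom u
  e ◃ s = proj₁ s , e ∷ proj₂ s

  ◃-injective : ∀ {u w} (e : T (arc u w)) {s t} → e ◃ s ≡ e ◃ t → s ≡ t
  ◃-injective e {_ , _} {_ , _} refl = refl

  next : ∀ {u x} → Fin n → Walk G u x → Fin n
  next v []                = v
  next v (_∷_ {w = w} _ _) = w

  prependAll : ∀ {u} ws → All (T ∘ arc u) ws → ((w : Fin n) → List (WalkFrom w)) →
               List (WalkFrom u)
  prependAll []       []       f = []
  prependAll (w ∷ ws) (e ∷ es) f = map (e ◃_) (f w) ++ prependAll ws es f

  walks : ℕ → (u : Fin n) → List (WalkFrom u)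
  walks zero    u = [ u , [] ]
  walks (suc j) u = (u , []) ∷ prependAll (outNbrs u) (outArcs u) (walks j)

  module _ {u : Fin n} where

    length-prependAll : ∀ ws es f {m} → (∀ w → length (f w) ≡ m) →
                        length (prependAll {u} ws es f) ≡ length ws * m
    length-prependAll []       []       f eq = refl
    length-prependAll (w ∷ ws) (e ∷ es) f eq = begin
      length (map (e ◃_) (f w) ++ prependAll ws es f)
        ≡⟨ length-++ (map (e ◃_) (f w)) ⟩
      length (map (e ◃_) (f w)) + length (prependAll ws es f)
        ≡⟨ cong₂ _+_ (trans (length-map _ (f w)) (eq w)) (length-prependAll ws es f eq) ⟩
      _ + length ws * _
        ∎
      where open ≡-Reasoning

    All-prependAll : ∀ {Q : WalkFrom u → Set} ws es f →
                     (∀ {w} → w ∈ ws → (e : T (arc u w)) → ∀ {s} → s ∈ f w → Q (e ◃ s)) →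
                     All Q (prependAll ws es f)
    All-prependAll []       []       f h = []
    All-prependAll (w ∷ ws) (e ∷ es) f h =
      All.++⁺ (All.map⁺ (All.tabulate (h (here refl) e)))
              (All-prependAll ws es f (λ w∈ → h (there w∈)))

    prependAll-unique : ∀ ws es f → Unique ws → (∀ w → Unique (f w)) →
                        Unique (prependAll {u} ws es f)
    prependAll-unique []       []       f []         f! = []
    prependAll-unique (w ∷ ws) (e ∷ es) f (w∉ ∷ ws!) f! =
      Unique.++⁺ (Unique.map⁺ (◃-injective e) (f! w)) (prependAll-unique ws es f ws! f!) disjoint
      where
      next∈ws : All (λ t → next u (proj₂ t) ∈ ws) (prependAll ws es f)
      next∈ws = All-prependAll ws es f (λ w′∈ _ _ → w′∈)

      disjoint : ∀ {t} → ¬ (t ∈ map (e ◃_) (f w) × t ∈ prependAll ws es f)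
      disjoint (t∈ , t∈′) with ∈-map⁻ (e ◃_) t∈
      ... | _ , _ , refl = All.lookup w∉ (All.lookup next∈ws t∈′) refl

  walks-length : ∀ {d} → OutRegular G d → ∀ j u → length (walks j u) ≡ M d j
  walks-length reg zero    u = refl
  walks-length {d} reg (suc j) u = begin
    suc (length (prependAll (outNbrs u) (outArcs u) (walks j)))
      ≡⟨ cong suc (length-prependAll (outNbrs u) (outArcs u) (walks j) (walks-length reg j)) ⟩
    suc (outdeg G u * M d j)
      ≡⟨ cong (λ o → suc (o * M d j)) (reg u) ⟩
    suc (d * M d j)
      ≡⟨ M-suc d j ⟩
    M d (suc j)
      ∎
    where open ≡-Reasoning

  walks-short : ∀ j u → All (λ s → ∣ s ∣ ≤ j) (walks j u)
  walks-short zero    u = z≤n ∷ []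
  walks-short (suc j) u =
    z≤n ∷ All-prependAll (outNbrs u) (outArcs u) (walks j)
            (λ {w} _ _ s∈ → s≤s (All.lookup (walks-short j w) s∈))

  walks-unique : ∀ j u → Unique (walks j u)
  walks-unique zero    u = [] ∷ []
  walks-unique (suc j) u =
    All-prependAll (outNbrs u) (outArcs u) (walks j) (λ _ _ _ ())
    ∷ prependAll-unique (outNbrs u) (outArcs u) (walks j) (outNbrs-unique u) (walks-unique j)

  _▷_ : ∀ {a b c} → Walk G a b → T (arc b c) → Walk G a c
  []      ▷ e = e ∷ []
  (h ∷ p) ▷ e = h ∷ (p ▷ e)

  length-▷ : ∀ {a b c} (p : Walk G a b) (e : T (arc b c)) →
             walkLength G (p ▷ e) ≡ suc (walkLength G p)
  length-▷ []      e = refl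
  length-▷ (h ∷ p) e = cong suc (length-▷ p e)

  penult : ∀ {a b} → Fin n → Walk G a b → Fin n
  penult z []                = z
  penult z (_∷_ {u = a} _ p) = penult a p

  penult-▷ : ∀ z {a b c} (p : Walk G a b) (e : T (arc b c)) → penult z (p ▷ e) ≡ b
  penult-▷ z []      e = refl
  penult-▷ z (h ∷ p) e = penult-▷ _ p e

  tail▷ : ∀ {u x v} (p : Walk G u x) → T (arc x v) → Walk G (next v p) v
  tail▷ []      e = []
  tail▷ (_ ∷ p) e = p ▷ e

  length-tail▷ : ∀ {u x v} (p : Walk G u x) (e : T (arc x v)) →
                 walkLength G (tail▷ p e) ≡ walkLength G p
  length-tail▷ []      e = refl
  length-tail▷ (_ ∷ p) e = length-▷ p e

  penult-tail▷ : ∀ {u x v} (p : Walk G u x) (e : T (arc x v)) → penult u (tail▷ p e) ≡ x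
  penult-tail▷ []      e = refl
  penult-tail▷ (_ ∷ p) e = penult-▷ _ p e

  next-arc : ∀ {u v x} → T (arc u v) → (p : Walk G u x) → T (arc u (next v p))
  next-arc uv []      = uv
  next-arc uv (h ∷ _) = h

  module _ {k : ℕ} (geo : Geodetic G k) where

    ends-injective : ∀ {u} (s t : WalkFrom u) → ∣ s ∣ ≤ k → ∣ t ∣ ≤ k →
                     proj₁ s ≡ proj₁ t → s ≡ t
    ends-injective (x , p) (.x , q) p≤k q≤k refl = cong (x ,_) (geo p q p≤k q≤k)

    ends-unique : ∀ u → Unique (map proj₁ (walks k u))
    ends-unique u = map⁺-injectiveOn (λ s∈ t∈ → ends-injective _ _ (short s∈) (short t∈)) (walks-unique k u)
      where
      short : ∀ {s} → s ∈ walks k u → ∣ s ∣ ≤ k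
      short = All.lookup (walks-short k u)

    next-injective : ∀ {u x y v} (p : Walk G u x) (q : Walk G u y) →
                     walkLength G p ≤ k → walkLength G q ≤ k →
                     (e : T (arc x v)) (e′ : T (arc y v)) → next v p ≡ next v q → x ≡ y
    next-injective {u} {x} {y} p q p≤k q≤k e e′ eq = begin
      x                       ≡⟨ penult-tail▷ p e ⟨
      penult u (tail▷ p e)    ≡⟨ short-walks-agree (tail▷ p e) (tail▷ q e′) eq
                                   (≤-trans (≤-reflexive (length-tail▷ p e)) p≤k)
                                   (≤-trans (≤-reflexive (length-tail▷ q e′)) q≤k) ⟩
      penult u (tail▷ q e′)   ≡⟨ penult-tail▷ q e′ ⟩
      y                       ∎
      where
      open ≡-Reasoning
      short-walks-agree : ∀ {a b v} (t : Walk G a v) (t′ : Walk G b v) → a ≡ b →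
                          walkLength G t ≤ k → walkLength G t′ ≤ k → penult u t ≡ penult u t′
      short-walks-agree t t′ refl t≤k t′≤k = cong (penult u) (geo t t′ t≤k t′≤k)

    module _ {u v : Fin n} where

      private
        W : List (WalkFrom u)
        W = walks k u

        E : List (Fin n)
        E = map proj₁ W

        into-v : List (WalkFrom u)
        into-v = filter (λ s → T? (arc (proj₁ s) v)) W

        outside : List (Fin n)
        outside = filter (λ x → ¬? (x ∈? E)) (inNbrs v)

      into-v≤outdeg : T (arc u v) → length into-v ≤ outdeg G u
      into-v≤outdeg uv = begin
        length into-v                          ≡⟨ length-map step into-v ⟨
        length (map step into-v)               ≤⟨ ⊆⇒length-≤ (map⁺-injectiveOn step-injective
                                                    (Unique.filter⁺ _ (walks-unique k u)))
                                                    step-out ⟩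
        outdeg G u                             ∎
        where
        open ≤-Reasoning
        step : WalkFrom u → Fin n
        step s = next v (proj₂ s)

        step-injective : ∀ {s t} → s ∈ into-v → t ∈ into-v → step s ≡ step t → s ≡ t
        step-injective {s} {t} s∈ t∈ eq with ∈-filter⁻ _ {xs = W} s∈ | ∈-filter⁻ _ {xs = W} t∈
        ... | s∈W , sv | t∈W , tv =
          ends-injective s t s≤k t≤k (next-injective (proj₂ s) (proj₂ t) s≤k t≤k sv tv eq)
          where
          s≤k : ∣ s ∣ ≤ k
          s≤k = All.lookup (walks-short k u) s∈W
          t≤k : ∣ t ∣ ≤ k
          t≤k = All.lookup (walks-short k u) t∈W

        step-out : ∀ {w} → w ∈ map step into-v → w ∈ outNbrs u
        step-out w∈ with ∈-map⁻ step w∈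
        ... | s , _ , refl = ∈-outNbrs⁺ (next-arc uv (proj₂ s))

      walks+outside≤n : length W + length outside ≤ n
      walks+outside≤n = begin
        length W + length outside ≡⟨ cong (_+ length outside) (length-map proj₁ W) ⟨
        length E + length outside ≡⟨ length-++ E ⟨
        length (E ++ outside)     ≤⟨ ⊆⇒length-≤ (Unique.++⁺ (ends-unique u)
                                       (Unique.filter⁺ _ (inNbrs-unique v))
                                       (λ (x∈E , x∈out) → proj₂ (∈-filter⁻ _ {xs = inNbrs v} x∈out) x∈E))
                                       (λ {x} _ → ∈-allFin x) ⟩
        length (allFin n)         ≡⟨ length-tabulate _ ⟩
        n                         ∎
        where open ≤-Reasoning

      inNbrs-⊆ : inNbrs v ⊆ map proj₁ into-v ++ outside
      inNbrs-⊆ {x} x∈ with x ∈? E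
      ... | no  x∉E = ∈-++⁺ʳ _ (∈-filter⁺ _ x∈ x∉E)
      ... | yes x∈E with ∈-map⁻ proj₁ x∈E
      ...   | s , s∈W , refl =
        ∈-++⁺ˡ (∈-map⁺ proj₁ (∈-filter⁺ _ s∈W (∈-inNbrs⁻ x∈)))

      indeg≤into-v+outside : indeg G v ≤ length into-v + length outside
      indeg≤into-v+outside = begin
        indeg G v                                  ≤⟨ ⊆⇒length-≤ (inNbrs-unique v) inNbrs-⊆ ⟩
        length (map proj₁ into-v ++ outside)       ≡⟨ length-++ (map proj₁ into-v) ⟩
        length (map proj₁ into-v) + length outside ≡⟨ cong (_+ length outside) (length-map proj₁ into-v) ⟩
        length into-v + length outside             ∎
        where open ≤-Reasoning

      indeg+walks≤outdeg+order : T (arc u v) → indeg G v + length W ≤ outdeg G u + n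
      indeg+walks≤outdeg+order uv = begin
        indeg G v + length W                        ≤⟨ +-monoˡ-≤ _ indeg≤into-v+outside ⟩
        length into-v + length outside + length W  ≡⟨ +-assoc (length into-v) _ _ ⟩
        length into-v + (length outside + length W) ≡⟨ cong (length into-v +_) (+-comm (length outside) _) ⟩
        length into-v + (length W + length outside) ≤⟨ +-mono-≤ (into-v≤outdeg uv) walks+outside≤n ⟩
        outdeg G u + n                              ∎
        where open ≤-Reasoning

lemma4 : (d k ε n : ℕ) → 1 ≤ k → (G : Digraph n) →
    Geodetic G k → OutRegular G d → ¬ Diregular G d →
    n ≡ M d k + ε →
    ∀ v' → d < indeg G v' → (d + 1 ≤ indeg G v' × indeg G v' ≤ d + ε)
lemma4 d k ε n _ G geo reg _ n≡ v' d<indeg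
  with u , uv ← in-neighbour G (<-≤-trans z<s d<indeg) =
  ≤-trans (≤-reflexive (+-comm d 1)) d<indeg , +-cancelʳ-≤ (M d k) _ _ (begin
    indeg G v' + M d k                 ≡⟨ cong (indeg G v' +_) (walks-length G reg k u) ⟨
    indeg G v' + length (walks G k u)  ≤⟨ indeg+walks≤outdeg+order G geo uv ⟩
    outdeg G u + n                     ≡⟨ cong₂ _+_ (reg u) n≡ ⟩
    d + (M d k + ε)                    ≡⟨ cong (d +_) (+-comm (M d k) ε) ⟩
    d + (ε + M d k)                    ≡⟨ +-assoc d ε (M d k) ⟨
    d + ε + M d k                      ∎)
  where open ≤-Reasoning
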